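{- Let $\tau$ be a valuation satisfying $\mathsf{Cl}(\Gamma)$. Then the local substitution $\sigma_\tau$ solves $\Gamma$.
   Context: $\mathcal{EL}$ concept terms are built from concept names and role names using $C\sqcap D$, $\exists r.C$ and $\top$; $C\sqsubseteq D$ means $C^{\mathcal I}\subseteq D^{\mathcal I}$ in every interpretation. Concept names are split into variables $N_v$ and constants $N_c$. $\Gamma$ is a flat disunification problem: subsumptions $C_1\sqcap\dots\sqcap C_n\sqsubseteq^? D$ of flat atoms (concept names or $\exists r.A$, $A$ a concept name) and dissubsumptions, all of the form $X\not\sqsubseteq^? Y$ with variables $X,Y$; $N_v,N_c,N_R$ are exactly the variables, constants and roles occurring in $\Gamma$. A substitution solves $\Gamma$ if $\sigma(C)\sqsubseteq\sigma(D)$ for each subsumption and $\sigma(X)\not\sqsubseteq\sigma(Y)$ for each dissubsumption. $\mathsf{At}$ = atoms occurring as subterms of $\Gamma$, $\mathsf{At_{nv}}=\mathsf{At}\setminus N_v$. $\mathsf{Cl}(\Gamma)$ is the clause set over propositional variables $[C\sqsubseteq D]$ ($C,D\in\mathsf{At}$), $[X>Y]$ ($X,Y\in N_v$), $p_{C,X,D}$ ($C\in\mathsf{At}$, $X\in N_v$, $D\in\mathsf{At_{nv}}$): (Ia) for each $C_1\sqcap\dots\sqcap C_n\sqsubseteq^? D$ in $\Gamma$ with $D\in\mathsf{At_{nv}}$: $[C_1\sqsubseteq D]\lor\dots\lor[C_n\sqsubseteq D]$; (Ib) for each $C_1\sqcap\dots\sqcap C_n\sqsubseteq^? X$ in $\Gamma$,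 $X\in N_v$, and $E\in\mathsf{At_{nv}}$: $[X\sqsubseteq E]\to[C_1\sqsubseteq E]\lor\dots\lor[C_n\sqsubseteq E]$; (Ic) for each $X\not\sqsubseteq^? Y$ in $\Gamma$: $\lnot[X\sqsubseteq Y]$; (IIa) $[A\sqsubseteq A]$ for $A\in N_c$; (IIb) $\lnot[A\sqsubseteq B]$ for distinct $A,B\in N_c$; (IIc) $\lnot[\exists r.A\sqsubseteq\exists s.B]$ for $\exists r.A,\exists s.B\in\mathsf{At_{nv}}$, $r\ne s$; (IId) $\lnot[A\sqsubseteq\exists r.B]$ and $\lnot[\exists r.B\sqsubseteq A]$ for $A\in N_c$, $\exists r.B\in\mathsf{At_{nv}}$; (IIe) $[\exists r.A\sqsubseteq\exists r.B]\to[A\sqsubseteq B]$ and $[A\sqsubseteq B]\to[\exists r.A\sqsubseteq\exists r.B]$; (III) $[C_1\sqsubseteq C_2]\land[C_2\sqsubseteq C_3]\to[C_1\sqsubseteq C_3]$ for $C_1,C_2,C_3\in\mathsf{At}$; (IV) for $C\in\mathsf{At}$, $X\in N_v$: $[C\sqsubseteq X]\lor\bigvee_{D\in\mathsf{At_{nv}}}p_{C,X,D}$, and for each $D\in\mathsf{At_{nv}}$: $p_{C,X,D}\to[X\sqsubseteq D]$ and $\lnot(p_{C,X,D}\land[C\sqsubseteq D])$; (Va) $\lnot[X>X]$; (Vb) $[X>Y]\land[Y>Z]\to[X>Z]$; (Vc) $[X\sqsubseteq\exists r.Y]\to[X>Y]$ for $X,Y\in N_v$ with $\exists r.Y\in\mathsf{At}$.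 For a satisfying $\tau$, let $S^\tau_X:=\{D\in\mathsf{At_{nv}}\mid\tau([X\sqsubseteq D])=1\}$; $>_{S^\tau}$ (transitive closure of $\{(X,Y)\mid Y\text{ occurs in an atom of }S^\tau_X\}$) is irreflexive, so $\sigma_\tau$ is defined inductively by $\sigma_\tau(X):=\sigma_\tau(D_1)\sqcap\dots\sqcap\sigma_\tau(D_k)$ for $S^\tau_X=\{D_1,\dots,D_k\}$ ($\top$ if empty), ground atoms being unchanged. -}

module Defs where

open import Data.Nat using (ℕ; suc)
open import Data.Bool using (Bool; true; false; T)
open import Data.List using (List; []; _∷_; _++_; concatMap; map; filterᵇ; length)
open import Data.List.Membership.Propositional using (_∈_)
open import Data.List.Relation.Unary.Any using (Any)
open import Data.Product using (_×_; _,_; Σ)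
open import Data.Sum using (_⊎_)
open import Relation.Nullary using (¬_)
open import Relation.Binary.PropositionalEquality using (_≢_)
open import Level using (Level; _⊔_) renaming (suc to lsuc; zero to lzero)

-- Names: concept names are variables (N_v) or constants (N_c), both
-- indexed by ℕ; role names are ℕ.

data Name : Set where
  var : ℕ → Name
  con : ℕ → Name

data Concept : Set where
  ⊤c   : Concept
  nm   : Name → Concept
  _⊓_  : Concept → Concept → Concept
  ∃c   : ℕ → Concept → Concept

data Atom : Set where
  at  : Name → Atom
  ∃a  : ℕ → Name → Atom

atomC : Atom → Concept
atomC (at n)   = nm n
atomC (∃a r n) = ∃c r (nm n)

conj : List Concept → Concept
conj []       = ⊤c
conj (C ∷ Cs) = C ⊓ conj Cs

record Interpretation : Set₁ where
  field
    Δ     : Set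
    nameI : Name → Δ → Set
    roleI : ℕ → Δ → Δ → Set

⟦_⟧ : Concept → (I : Interpretation) → Interpretation.Δ I → Set
⟦ ⊤c ⟧ I x = Data.Unit.⊤ where import Data.Unit
⟦ nm n ⟧ I x = Interpretation.nameI I n x
⟦ C ⊓ D ⟧ I x = ⟦ C ⟧ I x × ⟦ D ⟧ I x
⟦ ∃c r C ⟧ I x = Σ (Interpretation.Δ I) λ y → Interpretation.roleI I r x y × ⟦ C ⟧ I y

_⊑_ : Concept → Concept → Set₁
C ⊑ D = (I : Interpretation) (x : Interpretation.Δ I) → ⟦ C ⟧ I x → ⟦ D ⟧ I x

Subst : Set
Subst = ℕ → Concept

substName : Subst → Name → Concept
substName σ (var X) = σ X
substName σ (con A) = nm (con A)

substC : Subst → Concept → Concept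
substC σ ⊤c       = ⊤c
substC σ (nm n)   = substName σ n
substC σ (C ⊓ D)  = substC σ C ⊓ substC σ D
substC σ (∃c r C) = ∃c r (substC σ C)

substAtom : Subst → Atom → Concept
substAtom σ a = substC σ (atomC a)

-- A flat subsumption C₁ ⊓ … ⊓ Cₙ ⊑? D : (C₁ ∷ … ∷ Cₙ , D)
-- A dissubsumption X ⋢? Y between variables : (X , Y)
record Problem : Set where
  constructor problem
  field
    subs : List (List Atom × Atom)
    dis  : List (ℕ × ℕ)
open Problem public

subAtoms : Atom → List Atom
subAtoms (at n)   = at n ∷ []
subAtoms (∃a r n) = ∃a r n ∷ at n ∷ []

-- At : all atoms occurring (as subterms) in Γ (as a list, possibly with repetitions)
AtL : Problem → List Atom
AtL Γ = concatMap (λ { (Cs , D) → concatMap subAtoms (D ∷ Cs) }) (subs Γ)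
     ++ concatMap (λ { (X , Y) → at (var X) ∷ at (var Y) ∷ [] }) (dis Γ)

isNonVar : Atom → Bool
isNonVar (at (var _)) = false
isNonVar (at (con _)) = true
isNonVar (∃a _ _)     = true

NV : Atom → Set
NV a = T (isNonVar a)

AtNVL : Problem → List Atom
AtNVL Γ = filterᵇ isNonVar (AtL Γ)

v : ℕ → Atom
v X = at (var X)

c : ℕ → Atom
c A = at (con A)

-- Valuations of the propositional variables of Cl(Γ)
--   sub C D  = τ([C ⊑ D]),  gt X Y = τ([X > Y]),  p C X D = τ(p_{C,X,D})

record Valuation : Set where
  field
    sub : Atom → Atom → Bool
    gt  : ℕ → ℕ → Bool
    p   : Atom → ℕ → Atom → Bool
open Valuation public

record Satisfies (Γ : Problem) (τ : Valuation) : Set where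
  private
    At : Atom → Set
    At a = a ∈ AtL Γ
    ⟨_⊑_⟩ : Atom → Atom → Set
    ⟨ C ⊑ D ⟩ = T (sub τ C D)
    ⟨_>_⟩ : ℕ → ℕ → Set
    ⟨ X > Y ⟩ = T (gt τ X Y)
  field
    Ia  : ∀ {Cs D} → (Cs , D) ∈ subs Γ → NV D → Any (λ C → ⟨ C ⊑ D ⟩) Cs
    Ib  : ∀ {Cs X} → (Cs , v X) ∈ subs Γ → ∀ E → At E → NV E →
          ⟨ v X ⊑ E ⟩ → Any (λ C → ⟨ C ⊑ E ⟩) Cs
    Ic  : ∀ {X Y} → (X , Y) ∈ dis Γ → ¬ ⟨ v X ⊑ v Y ⟩
    IIa : ∀ A → At (c A) → ⟨ c A ⊑ c A ⟩
    IIb : ∀ A B → At (c A) → At (c B) → A ≢ B → ¬ ⟨ c A ⊑ c B ⟩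
    IIc : ∀ r s A B → At (∃a r A) → At (∃a s B) → r ≢ s →
          ¬ ⟨ ∃a r A ⊑ ∃a s B ⟩
    IId : ∀ A r B → At (c A) → At (∃a r B) →
          ¬ ⟨ c A ⊑ ∃a r B ⟩ × ¬ ⟨ ∃a r B ⊑ c A ⟩
    IIe : ∀ r A B → At (∃a r A) → At (∃a r B) →
          (⟨ ∃a r A ⊑ ∃a r B ⟩ → ⟨ at A ⊑ at B ⟩) ×
          (⟨ at A ⊑ at B ⟩ → ⟨ ∃a r A ⊑ ∃a r B ⟩)
    III : ∀ C₁ C₂ C₃ → At C₁ → At C₂ → At C₃ →
          ⟨ C₁ ⊑ C₂ ⟩ → ⟨ C₂ ⊑ C₃ ⟩ → ⟨ C₁ ⊑ C₃ ⟩
    IV₁ : ∀ C X → At C → At (v X) →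
          ⟨ C ⊑ v X ⟩ ⊎ Σ Atom (λ D → At D × NV D × T (p τ C X D))
    IV₂ : ∀ C X D → At C → At (v X) → At D → NV D →
          T (p τ C X D) → ⟨ v X ⊑ D ⟩
    IV₃ : ∀ C X D → At C → At (v X) → At D → NV D →
          ¬ (T (p τ C X D) × ⟨ C ⊑ D ⟩)
    Va  : ∀ X → At (v X) → ¬ ⟨ X > X ⟩
    Vb  : ∀ X Y Z → At (v X) → At (v Y) → At (v Z) →
          ⟨ X > Y ⟩ → ⟨ Y > Z ⟩ → ⟨ X > Z ⟩
    Vc  : ∀ X Y r → At (v X) → At (v Y) → At (∃a r (var Y)) →
          ⟨ v X ⊑ ∃a r (var Y) ⟩ → ⟨ X > Y ⟩

-- The local substitution σ_τ.
-- σ_τ(X) = σ_τ(D₁) ⊓ … ⊓ σ_τ(D_k) for S^τ_X = {D₁,…,D_k}, defined by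
-- recursion along >_{S^τ}.  We unfold this recursion with a fuel bound:
-- σ-fuel k X computes the defining equation k levels deep.  Since >_{S^τ}
-- is acyclic on the variables of Γ, every descending chain has length at
-- most |N_v| ≤ length (AtL Γ), so with fuel suc (length (AtL Γ)) the
-- result is exactly the inductively defined σ_τ.

S : Problem → Valuation → ℕ → List Atom
S Γ τ X = filterᵇ (sub τ (v X)) (AtNVL Γ)

σ-fuel : Problem → Valuation → ℕ → Subst
σ-fuel Γ τ 0       X = ⊤c
σ-fuel Γ τ (suc k) X = conj (map (substAtom (σ-fuel Γ τ k)) (S Γ τ X))

σ_ : Problem → Valuation → Subst
σ_ Γ τ = σ-fuel Γ τ (suc (length (AtL Γ)))

record Solves (Γ : Problem) (σ : Subst) : Set₁ where
  field
    solSub : ∀ {Cs D} → (Cs , D) ∈ subs Γ →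
             substC σ (conj (map atomC Cs)) ⊑ substAtom σ D
    solDis : ∀ {X Y} → (X , Y) ∈ dis Γ → ¬ (σ X ⊑ σ Y)

module Submission where

-- Soundness: if τ sets [C ⊑ D] with D not a variable, then σ_τ(C) ⊑ σ_τ(D).
-- Clauses (V) bound the depth of the recursion defining σ_τ, so σ_τ(X) unfolds
-- to the conjunction of σ_τ(S^τ_X); together with transitivity (III) and the
-- clauses (II) this gives soundness, and the subsumptions of Γ follow by (Ia, Ib).
-- Refutation: in the canonical interpretation, whose elements are concept terms
-- carrying their top-level conjuncts, every term belongs to itself. If τ rejects
-- [A ⊑ D] then σ_τ(A) is not in σ_τ(D) there, clause (IV) reducing a variable D
-- to a non-variable one; so σ_τ(X) ⊑ σ_τ(Y) is impossible when (Ic) rejects [X ⊑ Y].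

open import Defs
open import Data.Nat using (ℕ; zero; suc; _<_; _≤_; s≤s; _≟_)
open import Data.Nat.Properties using (<-≤-trans; m≤n⇒m≤1+n; module ≤-Reasoning)
open import Data.Bool using (Bool; true; false; T)
open import Data.Bool.Properties using (T?)
open import Data.Unit using (tt)
open import Data.Empty using (⊥-elim)
open import Data.List using (List; []; _∷_; _++_; concatMap; map; filterᵇ; length)
open import Data.List.Properties using (length-filter; filter-notAll; map-cong-local)
open import Data.List.Membership.Propositional using (_∈_; find; lose)
open import Data.List.Membership.Propositional.Properties
  using (∈-++⁺ˡ; ∈-++⁺ʳ; ∈-++⁻; ∈-concatMap⁺; ∈-concatMap⁻; ∈-filter⁺; ∈-filter⁻)
open import Data.List.Relation.Unary.All as All using (All; []; _∷_)
open import Data.List.Relation.Unary.All.Properties as All using ()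
open import Data.List.Relation.Unary.Any as Any using (Any; here; there)
open import Data.List.Relation.Unary.Any.Properties as Any using ()
open import Data.Product using (_×_; _,_; ∃; proj₁; proj₂)
open import Data.Sum using (_⊎_; inj₁; inj₂)
open import Function using (_∘_; id)
open import Relation.Nullary using (¬_; yes; no)
open import Relation.Binary.PropositionalEquality using (_≡_; refl; sym; cong; subst)

filterᵇ-absorbs : {A : Set} (p q : A → Bool) →
                  ∀ xs → (∀ {a} → a ∈ xs → T (p a) → T (q a)) →
                  filterᵇ p (filterᵇ q xs) ≡ filterᵇ p xs
filterᵇ-absorbs p q [] p⇒q = refl
filterᵇ-absorbs p q (x ∷ xs) p⇒q with q x in qx
... | true with p x
...   | true  = cong (x ∷_) (filterᵇ-absorbs p q xs (p⇒q ∘ there))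
...   | false = filterᵇ-absorbs p q xs (p⇒q ∘ there)
filterᵇ-absorbs p q (x ∷ xs) p⇒q | false with p x in px
...   | false = filterᵇ-absorbs p q xs (p⇒q ∘ there)
...   | true  = ⊥-elim (subst T qx (p⇒q (here refl) (subst T (sym px) tt)))

length-filterᵇ-< : {A : Set} (p q : A → Bool) →
                   ∀ {xs} → (∀ {a} → a ∈ xs → T (p a) → T (q a)) →
                   ∀ {a} → a ∈ xs → T (q a) → ¬ T (p a) →
                   length (filterᵇ p xs) < length (filterᵇ q xs)
length-filterᵇ-< p q {xs} p⇒q a∈xs qa ¬pa = begin-strict
  length (filterᵇ p xs)                ≡⟨ cong length (sym (filterᵇ-absorbs p q xs p⇒q)) ⟩
  length (filterᵇ p (filterᵇ q xs))    <⟨ filter-notAll (T? ∘ p) (filterᵇ q xs) a∉p ⟩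
  length (filterᵇ q xs)                ∎
  where
  open ≤-Reasoning
  a∉p : Any (¬_ ∘ T ∘ p) (filterᵇ q xs)
  a∉p = lose (∈-filter⁺ (T? ∘ q) a∈xs qa) ¬pa

⟦substC-conj⟧⁻ : ∀ σ Cs (I : Interpretation) {x} → ⟦ substC σ (conj Cs) ⟧ I x →
                 All (λ C → ⟦ substC σ C ⟧ I x) Cs
⟦substC-conj⟧⁻ σ []       I _            = []
⟦substC-conj⟧⁻ σ (C ∷ Cs) I (x∈C , x∈Cs) = x∈C ∷ ⟦substC-conj⟧⁻ σ Cs I x∈Cs

⟦conj⟧⁻ : ∀ {Cs} (I : Interpretation) {x} → ⟦ conj Cs ⟧ I x → All (λ C → ⟦ C ⟧ I x) Cs
⟦conj⟧⁻ {[]}     I _            = []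
⟦conj⟧⁻ {C ∷ Cs} I (x∈C , x∈Cs) = x∈C ∷ ⟦conj⟧⁻ I x∈Cs

⟦conj⟧⁺ : ∀ {Cs} (I : Interpretation) {x} → All (λ C → ⟦ C ⟧ I x) Cs → ⟦ conj Cs ⟧ I x
⟦conj⟧⁺ I []           = tt
⟦conj⟧⁺ I (x∈C ∷ x∈Cs) = x∈C , ⟦conj⟧⁺ I x∈Cs

infix 4 _∈⊓_
data _∈⊓_ : Concept → Concept → Set where
  nm-self : ∀ {n} → nm n ∈⊓ nm n
  ∃-self  : ∀ {r C} → ∃c r C ∈⊓ ∃c r C
  ⊓ˡ      : ∀ {a C D} → a ∈⊓ C → a ∈⊓ C ⊓ D
  ⊓ʳ      : ∀ {a C D} → a ∈⊓ D → a ∈⊓ C ⊓ D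

∈⊓-conj⁻ : ∀ {a} Cs → a ∈⊓ conj Cs → Any (a ∈⊓_) Cs
∈⊓-conj⁻ (C ∷ Cs) (⊓ˡ a∈C)  = here a∈C
∈⊓-conj⁻ (C ∷ Cs) (⊓ʳ a∈Cs) = there (∈⊓-conj⁻ Cs a∈Cs)

canonical : Interpretation
canonical = record
  { Δ     = Concept
  ; nameI = λ n C → nm n ∈⊓ C
  ; roleI = λ r C C′ → ∃c r C′ ∈⊓ C
  }

∈canonical-of-conjuncts : ∀ C {X} → (∀ {a} → a ∈⊓ C → a ∈⊓ X) → ⟦ C ⟧ canonical X
∈canonical-of-conjuncts ⊤c       C⊆X = tt
∈canonical-of-conjuncts (nm n)   C⊆X = C⊆X nm-self
∈canonical-of-conjuncts (C ⊓ D)  C⊆X =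
  ∈canonical-of-conjuncts C (C⊆X ∘ ⊓ˡ) , ∈canonical-of-conjuncts D (C⊆X ∘ ⊓ʳ)
∈canonical-of-conjuncts (∃c r C) C⊆X = C , C⊆X ∃-self , ∈canonical-of-conjuncts C id

∈canonical-self : ∀ C → ⟦ C ⟧ canonical C
∈canonical-self C = ∈canonical-of-conjuncts C id

subAtoms-self : ∀ a → a ∈ subAtoms a
subAtoms-self (at n)   = here refl
subAtoms-self (∃a r n) = here refl

FillerClosed : List Atom → Set
FillerClosed L = ∀ {r n} → ∃a r n ∈ L → at n ∈ L

subAtoms-closed : ∀ a → FillerClosed (subAtoms a)
subAtoms-closed (∃a r n) (here refl)       = there (here refl)
subAtoms-closed (∃a _ _) (there (here ()))
subAtoms-closed (at _)   (here ())

names-closed : ∀ m n → FillerClosed (at m ∷ at n ∷ [])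
names-closed m n (there (here ()))
names-closed m n (here ())

++-closed : ∀ {L M} → FillerClosed L → FillerClosed M → FillerClosed (L ++ M)
++-closed {L} L-cl M-cl r∃n∈ with ∈-++⁻ L r∃n∈
... | inj₁ r∃n∈L = ∈-++⁺ˡ (L-cl r∃n∈L)
... | inj₂ r∃n∈M = ∈-++⁺ʳ L (M-cl r∃n∈M)

concatMap-closed : {A : Set} (f : A → List Atom) → (∀ x → FillerClosed (f x)) →
                   ∀ xs → FillerClosed (concatMap f xs)
concatMap-closed f f-cl xs r∃n∈ =
  ∈-concatMap⁺ f {xs} (Any.map (λ {x} → f-cl x) (∈-concatMap⁻ f {xs} r∃n∈))

AtL-closed : ∀ Γ → FillerClosed (AtL Γ)
AtL-closed Γ = ++-closed
  (concatMap-closed _ (λ { (Cs , D) → concatMap-closed subAtoms subAtoms-closed (D ∷ Cs) }) (subs Γ))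
  (concatMap-closed _ (λ { (X , Y) → names-closed (var X) (var Y) }) (dis Γ))

module AtomsOf (Γ : Problem) where

  At : Atom → Set
  At a = a ∈ AtL Γ

  rhs∈At : ∀ {Cs D} → (Cs , D) ∈ subs Γ → At D
  rhs∈At {Cs} {D} m =
    ∈-++⁺ˡ (∈-concatMap⁺ _ (lose m (∈-concatMap⁺ subAtoms {D ∷ Cs} (here (subAtoms-self D)))))

  lhs∈At : ∀ {Cs D C} → (Cs , D) ∈ subs Γ → C ∈ Cs → At C
  lhs∈At {Cs} {D} {C} m C∈Cs =
    ∈-++⁺ˡ (∈-concatMap⁺ _ (lose m
      (∈-concatMap⁺ subAtoms {D ∷ Cs} (there (lose C∈Cs (subAtoms-self C))))))

  dis-left∈At : ∀ {X Y} → (X , Y) ∈ dis Γ → At (v X)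
  dis-left∈At m = ∈-++⁺ʳ _ (∈-concatMap⁺ _ (lose m (here refl)))

  dis-right∈At : ∀ {X Y} → (X , Y) ∈ dis Γ → At (v Y)
  dis-right∈At m = ∈-++⁺ʳ _ (∈-concatMap⁺ _ (lose m (there (here refl))))

  filler∈At : ∀ {r n} → At (∃a r n) → At (at n)
  filler∈At = AtL-closed Γ

module LocalSubstitution (Γ : Problem) (τ : Valuation) (sat : Satisfies Γ τ) where
  open AtomsOf Γ
  open Satisfies sat

  ⟨_⊑_⟩ : Atom → Atom → Set
  ⟨ C ⊑ D ⟩ = T (sub τ C D)

  στ : Subst
  στ = σ_ Γ τ

  ∈S⁻ : ∀ {X E} → E ∈ S Γ τ X → ⟨ v X ⊑ E ⟩ × NV E × At E
  ∈S⁻ {X} E∈S =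
    let E∈AtNV , X⊑E = ∈-filter⁻ (T? ∘ sub τ (v X)) {xs = AtNVL Γ} E∈S
        E∈At , nv    = ∈-filter⁻ (T? ∘ isNonVar) {xs = AtL Γ} E∈AtNV
    in X⊑E , nv , E∈At

  ∈S⁺ : ∀ {X E} → At E → NV E → ⟨ v X ⊑ E ⟩ → E ∈ S Γ τ X
  ∈S⁺ {X} E∈At nv X⊑E =
    ∈-filter⁺ (T? ∘ sub τ (v X)) (∈-filter⁺ (T? ∘ isNonVar) E∈At nv) X⊑E

  ⊑-var-or-separated : ∀ C Y → At C → At (v Y) →
    ⟨ C ⊑ v Y ⟩ ⊎ ∃ λ D → At D × NV D × ⟨ v Y ⊑ D ⟩ × ¬ ⟨ C ⊑ D ⟩
  ⊑-var-or-separated C Y C∈At Y∈At with IV₁ C Y C∈At Y∈At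
  ... | inj₁ C⊑Y = inj₁ C⊑Y
  ... | inj₂ (D , D∈At , nv , p) =
    inj₂ (D , D∈At , nv , IV₂ C Y D C∈At Y∈At D∈At nv p ,
          λ C⊑D → IV₃ C Y D C∈At Y∈At D∈At nv (p , C⊑D))

  -- rank X bounds the depth of the recursion defining σ_τ(X).
  below : ℕ → Atom → Bool
  below X (at (var Y)) = gt τ X Y
  below X (at (con _)) = false
  below X (∃a _ _)     = false

  rank : ℕ → ℕ
  rank X = length (filterᵇ (below X) (AtL Γ))

  rank-< : ∀ {X Y} → At (v X) → At (v Y) → T (gt τ X Y) → rank Y < rank X
  rank-< {X} {Y} X∈At Y∈At X>Y =
    length-filterᵇ-< (below Y) (below X) Y>⇒X> Y∈At X>Y (Va Y Y∈At)
    where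
    Y>⇒X> : ∀ {a} → At a → T (below Y a) → T (below X a)
    Y>⇒X> {at (var Z)} Z∈At Y>Z = Vb X Y Z X∈At Y∈At Z∈At X>Y Y>Z

  rank-≤ : ∀ X → rank X ≤ length (AtL Γ)
  rank-≤ X = length-filter (T? ∘ below X) (AtL Γ)

  conj-S-cong : ∀ {X} (σ₁ σ₂ : Subst) → At (v X) →
    (∀ {Z} → At (v Z) → rank Z < rank X → σ₁ Z ≡ σ₂ Z) →
    conj (map (substAtom σ₁) (S Γ τ X)) ≡ conj (map (substAtom σ₂) (S Γ τ X))
  conj-S-cong {X} σ₁ σ₂ X∈At agree = cong conj (map-cong-local (All.tabulate same))
    where
    same : ∀ {E} → E ∈ S Γ τ X → substAtom σ₁ E ≡ substAtom σ₂ E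
    same {at (con _)}    _   = refl
    same {∃a r (con _)}  _   = refl
    same {at (var _)}    E∈S = ⊥-elim (proj₁ (proj₂ (∈S⁻ E∈S)))
    same {∃a r (var Z)}  E∈S =
      let X⊑E , _ , E∈At = ∈S⁻ E∈S
          Z∈At = filler∈At E∈At
      in cong (∃c r) (agree Z∈At (rank-< X∈At Z∈At (Vc X Z r X∈At Z∈At E∈At X⊑E)))

  σ-fuel-stable : ∀ j k {Y} → At (v Y) → rank Y < j → rank Y < k →
                  σ-fuel Γ τ j Y ≡ σ-fuel Γ τ k Y
  σ-fuel-stable (suc j) (suc k) Y∈At (s≤s rY≤j) (s≤s rY≤k) =
    conj-S-cong (σ-fuel Γ τ j) (σ-fuel Γ τ k) Y∈At λ Z∈At Z<Y →
      σ-fuel-stable j k Z∈At (<-≤-trans Z<Y rY≤j) (<-≤-trans Z<Y rY≤k)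

  στ-unfold : ∀ {X} → At (v X) → στ X ≡ conj (map (substAtom στ) (S Γ τ X))
  στ-unfold {X} X∈At = conj-S-cong _ _ X∈At λ Z∈At Z<X →
    let rZ<N = <-≤-trans Z<X (rank-≤ X)
    in σ-fuel-stable (length (AtL Γ)) (suc (length (AtL Γ))) Z∈At rZ<N (m≤n⇒m≤1+n rZ<N)

  στ-⊑-S : ∀ {X E} → At (v X) → E ∈ S Γ τ X → στ X ⊑ substAtom στ E
  στ-⊑-S X∈At E∈S I x x∈σX =
    All.lookup (All.map⁻ (⟦conj⟧⁻ I (subst (λ C → ⟦ C ⟧ I x) (στ-unfold X∈At) x∈σX))) E∈S

  ∈στ-intro : ∀ {X} → At (v X) → (I : Interpretation) {x : Interpretation.Δ I} →
             (∀ {E} → E ∈ S Γ τ X → ⟦ substAtom στ E ⟧ I x) → ⟦ στ X ⟧ I x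
  ∈στ-intro X∈At I {x} x∈S =
    subst (λ C → ⟦ C ⟧ I x) (sym (στ-unfold X∈At)) (⟦conj⟧⁺ I (All.map⁺ (All.tabulate x∈S)))

  ⊑-sound-name : ∀ n D → At (at n) → At D → NV D → ⟨ at n ⊑ D ⟩ →
                 substName στ n ⊑ substAtom στ D
  ⊑-sound-name (var X) D X∈At D∈At nv X⊑D = στ-⊑-S X∈At (∈S⁺ D∈At nv X⊑D)
  ⊑-sound-name (con A) (at (con B)) A∈At B∈At _ A⊑B with A ≟ B
  ... | yes refl = λ _ _ x∈A → x∈A
  ... | no A≢B   = ⊥-elim (IIb A B A∈At B∈At A≢B A⊑B)
  ⊑-sound-name (con A) (∃a r B) A∈At D∈At _ A⊑D = ⊥-elim (proj₁ (IId A r B A∈At D∈At) A⊑D)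

  ⊑-sound-names : ∀ A B → At (at A) → At (at B) → ⟨ at A ⊑ at B ⟩ →
                  substName στ A ⊑ substName στ B
  ⊑-sound-names A (con B) A∈At B∈At A⊑B = ⊑-sound-name A (c B) A∈At B∈At tt A⊑B
  ⊑-sound-names A (var Y) A∈At Y∈At A⊑Y I x x∈A = ∈στ-intro Y∈At I λ E∈S →
    let Y⊑E , nv , E∈At = ∈S⁻ E∈S
    in ⊑-sound-name A _ A∈At E∈At nv (III (at A) (v Y) _ A∈At Y∈At E∈At A⊑Y Y⊑E) I x x∈A

  ⊑-sound : ∀ C D → At C → At D → NV D → ⟨ C ⊑ D ⟩ → substAtom στ C ⊑ substAtom στ D
  ⊑-sound (at n) D = ⊑-sound-name n D
  ⊑-sound (∃a r A) (at (con B)) C∈At B∈At _ C⊑B = ⊥-elim (proj₂ (IId B r A B∈At C∈At) C⊑B)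
  ⊑-sound (∃a r A) (∃a s B) C∈At D∈At _ C⊑D with r ≟ s
  ... | no r≢s   = ⊥-elim (IIc r s A B C∈At D∈At r≢s C⊑D)
  ... | yes refl = λ { I x (y , xry , y∈A) →
    y , xry , ⊑-sound-names A B (filler∈At C∈At) (filler∈At D∈At) (proj₁ (IIe r A B C∈At D∈At) C⊑D) I y y∈A }

  counterexample-name : ∀ k A B → At (at A) → At (at B) → ¬ ⟨ at A ⊑ at B ⟩ →
    ¬ ⟦ substName στ B ⟧ canonical (substName (σ-fuel Γ τ k) A)
  counterexample-nonvar : ∀ k A D → At (at A) → At D → NV D → ¬ ⟨ at A ⊑ D ⟩ →
    ¬ ⟦ substAtom στ D ⟧ canonical (substName (σ-fuel Γ τ k) A)

  counterexample-name k A (con B) A∈At B∈At A⋢B = counterexample-nonvar k A (c B) A∈At B∈At tt A⋢B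
  counterexample-name k A (var Y) A∈At Y∈At A⋢Y ∈στY with ⊑-var-or-separated (at A) Y A∈At Y∈At
  ... | inj₁ A⊑Y = A⋢Y A⊑Y
  ... | inj₂ (D , D∈At , nv , Y⊑D , A⋢D) =
    counterexample-nonvar k A D A∈At D∈At nv A⋢D (⊑-sound (v Y) D Y∈At D∈At nv Y⊑D canonical _ ∈στY)

  counterexample-nonvar k (con A) (at (con B)) A∈At _ _ A⋢B nm-self = A⋢B (IIa A A∈At)
  counterexample-nonvar k (con A) (∃a r B) _ _ _ _ (_ , () , _)
  counterexample-nonvar zero (var X) (at (con B)) _ _ _ _ ()
  counterexample-nonvar zero (var X) (∃a r B) _ _ _ _ (_ , () , _)
  counterexample-nonvar (suc k) (var X) (at (con B)) _ _ _ X⋢B B∈⊓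
    with find (Any.map⁻ (∈⊓-conj⁻ _ B∈⊓))
  ... | at (con _) , E∈S , nm-self = X⋢B (proj₁ (∈S⁻ E∈S))
  ... | at (var _) , E∈S , _       = ⊥-elim (proj₁ (proj₂ (∈S⁻ E∈S)))
  ... | ∃a _ _     , _   , ()
  counterexample-nonvar (suc k) (var X) (∃a r B) X∈At D∈At _ X⋢D (y , ∃∈⊓ , y∈B)
    with find (Any.map⁻ (∈⊓-conj⁻ _ ∃∈⊓))
  ... | at (con _) , _   , ()
  ... | at (var _) , E∈S , _       = ⊥-elim (proj₁ (proj₂ (∈S⁻ E∈S)))
  ... | ∃a r Z     , E∈S , ∃-self  =
    let X⊑E , _ , E∈At = ∈S⁻ E∈S
        E⊑D = proj₂ (IIe r Z B E∈At D∈At)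
    in counterexample-name k Z B (filler∈At E∈At) (filler∈At D∈At)
         (λ Z⊑B → X⋢D (III (v X) (∃a r Z) (∃a r B) X∈At E∈At D∈At X⊑E (E⊑D Z⊑B))) y∈B

  lhs-⊑ : ∀ {Cs D E} → (Cs , D) ∈ subs Γ → At E → NV E → Any (λ C → ⟨ C ⊑ E ⟩) Cs →
          substC στ (conj (map atomC Cs)) ⊑ substAtom στ E
  lhs-⊑ {Cs} m E∈At nv some I x x∈lhs =
    let C , C∈Cs , C⊑E = find some
    in ⊑-sound C _ (lhs∈At m C∈Cs) E∈At nv C⊑E I x
         (All.lookup (All.map⁻ (⟦substC-conj⟧⁻ στ (map atomC Cs) I x∈lhs)) C∈Cs)

  solves-sub : ∀ {Cs D} → (Cs , D) ∈ subs Γ → substC στ (conj (map atomC Cs)) ⊑ substAtom στ D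
  solves-sub {D = at (var X)} m I x x∈lhs = ∈στ-intro (rhs∈At m) I λ E∈S →
    let X⊑E , nv , E∈At = ∈S⁻ E∈S
    in lhs-⊑ m E∈At nv (Ib m _ E∈At nv X⊑E) I x x∈lhs
  solves-sub {D = at (con A)} m = lhs-⊑ m (rhs∈At m) tt (Ia m tt)
  solves-sub {D = ∃a r B}     m = lhs-⊑ m (rhs∈At m) tt (Ia m tt)

  solves-dis : ∀ {X Y} → (X , Y) ∈ dis Γ → ¬ (στ X ⊑ στ Y)
  solves-dis {X} {Y} m σX⊑σY with ⊑-var-or-separated (v X) Y (dis-left∈At m) (dis-right∈At m)
  ... | inj₁ X⊑Y = Ic m X⊑Y
  ... | inj₂ (D , D∈At , nv , Y⊑D , X⋢D) =
    counterexample-nonvar (suc (length (AtL Γ))) (var X) D (dis-left∈At m) D∈At nv X⋢D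
      (⊑-sound (v Y) D (dis-right∈At m) D∈At nv Y⊑D canonical (στ X)
        (σX⊑σY canonical (στ X) (∈canonical-self (στ X))))

lemma6p5 : (Γ : Problem) (τ : Valuation) → Satisfies Γ τ → Solves Γ (σ_ Γ τ)
lemma6p5 Γ τ sat = record { solSub = solves-sub ; solDis = solves-dis }
  where open LocalSubstitution Γ τ sat
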